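{- Let $n\ge3$, $p\in[1,2n-2]$, and $\gamma,\delta\in P(n-2,n)$ with $|\delta|=|\gamma|+p$. If $\gamma\to\delta$ and $\gamma\not\subseteq\delta$, then $\delta=\gamma^*:=(\gamma_1+p+1,\gamma_2-1)$.
   Context: $P(n-2,n)$ is the set of partitions $\gamma=(\gamma_1,\gamma_2)$ inside a $2\times(2n-2)$ rectangle that are $(n-2)$-strict ($\gamma_1>\gamma_2$ whenever $\gamma_1>n-2$). Boxes are identified as $(r:c)$ (row $r$, column $c$). The box $(r:c)$ is related to $(r':c')$ if $|c-(n-1)|+r=|c'-(n-1)|+r'$. Write $\delta\setminus\gamma$ for boxes of $\delta$ not in $\gamma$, and $\gamma\setminus\delta$ for boxes of $\gamma$ not in $\delta$. The relation $\gamma\to\delta$ holds if $\delta$ can be obtained from $\gamma$ by removing a vertical strip (at most one box per row) from the first $n-2$ columns of $\gamma$ and then adding a horizontal strip (at most one box per column), such that (1) each box of $\gamma$ in the first $n-2$ columns having no box of $\delta$ below it is related to at most one box of $\delta\setminus\gamma$; and (2) every box of $\gamma\setminus\delta$, and the box above it, is each related to exactly one box of $\delta\setminus\gamma$, and these boxes of $\delta\setminus\gamma$ all lie in the same row. -}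

module Defs where

open import Data.Nat using (ℕ; zero; suc; _+_; _*_; _∸_; _≤_; _<_; ∣_-_∣)
open import Data.Product using (Σ; _×_; _,_; proj₁; proj₂)
open import Data.Sum using (_⊎_)
open import Relation.Nullary using (¬_)
open import Relation.Binary.PropositionalEquality using (_≡_)

-- A partition with at most two rows: (γ₁ , γ₂).
Partition : Set
Partition = ℕ × ℕ

size : Partition → ℕ
size (a , b) = a + b

-- γ ∈ P(n-2,n): a partition in a 2 × (2n-2) rectangle which is (n-2)-strict
-- (γ₁ > γ₂ whenever γ₁ > n-2).
InP : ℕ → Partition → Set
InP n (a , b) = (b ≤ a) × (a ≤ 2 * n ∸ 2) × (n ∸ 2 < a → b < a)

-- A box (r : c), row r, column c, both 1-indexed.
Box : Set
Box = ℕ × ℕ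

row : Box → ℕ
row = proj₁

col : Box → ℕ
col = proj₂

rowLen : Partition → ℕ → ℕ
rowLen (a , b) 1 = a
rowLen (a , b) 2 = b
rowLen (a , b) _ = 0

_∈D_ : Box → Partition → Set
(r , c) ∈D γ = (1 ≤ c) × (c ≤ rowLen γ r)

_∈_∖_ : Box → Partition → Partition → Set
x ∈ δ ∖ γ = (x ∈D δ) × ¬ (x ∈D γ)

_⊆P_ : Partition → Partition → Set
(a , b) ⊆P (a' , b') = (a ≤ a') × (b ≤ b')

Related : ℕ → Box → Box → Set
Related n (r , c) (r' , c') = ∣ c - (n ∸ 1) ∣ + r ≡ ∣ c' - (n ∸ 1) ∣ + r'

AtMostOneRel : ℕ → Partition → Partition → Box → Set
AtMostOneRel n γ δ x =
  ∀ y z → y ∈ δ ∖ γ → Related n x y → z ∈ δ ∖ γ → Related n x z → y ≡ z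

ExactlyOneRel : ℕ → Partition → Partition → Box → Set
ExactlyOneRel n γ δ x =
  Σ Box (λ y → (y ∈ δ ∖ γ) × Related n x y × (∀ z → z ∈ δ ∖ γ → Related n x z → z ≡ y))

-- the boxes of γ \ δ together with the box above each of them
-- (the box above (2:c) is (1:c); a box in row 1 has no box above it)
InRemovedOrAbove : Partition → Partition → Box → Set
InRemovedOrAbove γ δ x = (x ∈ γ ∖ δ) ⊎ ((row x ≡ 1) × ((2 , col x) ∈ γ ∖ δ))

-- γ / ε is a vertical strip (at most one box per row) contained in the
-- first k columns of γ; ε ⊆ γ is a partition.
VStripFirstCols : ℕ → Partition → Partition → Set
VStripFirstCols k γ ε =
  (proj₂ ε ≤ proj₁ ε) × (ε ⊆P γ)
  × (proj₁ γ ≤ suc (proj₁ ε)) × (proj₂ γ ≤ suc (proj₂ ε))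
  × (∀ x → x ∈ γ ∖ ε → col x ≤ k)

-- δ / ε is a horizontal strip (at most one box per column)
HStrip : Partition → Partition → Set
HStrip ε δ = (ε ⊆P δ) × (proj₂ δ ≤ proj₁ ε)

Arrow : ℕ → Partition → Partition → Set
Arrow n γ δ =
  Σ Partition (λ ε → VStripFirstCols (n ∸ 2) γ ε × HStrip ε δ)
  × (∀ x → x ∈D γ → col x ≤ n ∸ 2 → ¬ ((suc (row x) , col x) ∈D δ)
       → AtMostOneRel n γ δ x)
  -- (2): each box of γ \ δ and the box above it is related to exactly one
  -- box of δ \ γ, all these boxes lying in one common row ρ
  × Σ ℕ (λ ρ → ∀ x → InRemovedOrAbove γ δ x →
       ExactlyOneRel n γ δ x
       × (∀ y → y ∈ δ ∖ γ → Related n x y → row y ≡ ρ))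

module Submission where

-- Write γ = (a , b) and δ = (a' , b').  The argument has two halves.
--  * The first row cannot shrink (a ≤ a').  Otherwise the corner box (1:a)
--    of γ lies in γ ∖ δ, so by condition (2) it needs a partner in δ ∖ γ
--    related to it.  The vertical strip lives in the first n−2 columns, so
--    a ≤ n−2, while every box of δ ∖ γ sits in row 2 at a column c ≤ a.
--    Such a box is at least as far from the pivot column n−1 as (1:a) and
--    one row lower, so it is never related to (1:a).
--  * Hence γ ⊄ δ forces b' < b, and as the vertical strip removes at most one
--    box of row 2 while the horizontal strip never shrinks it, b = b' + 1.
--    The size condition then pins down a' = a + p + 1.
-- The file proves the "no partner" geometry, the two row facts about
-- arrows, and the size arithmetic, and combines them at the end.

open import Defs
open import Data.Nat using (ℕ; _+_; _*_; _∸_; _≤_; _<_; suc; zero; s≤s; z≤n; _≤?_; ∣_-_∣)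
open import Data.Nat.Properties
open import Data.Nat.Solver using (module +-*-Solver)
open import Data.Product using (_,_; proj₁; proj₂)
open import Data.Sum using (inj₁)
open import Data.Empty using (⊥-elim)
open import Relation.Nullary using (¬_; yes; no)
open import Relation.Binary.PropositionalEquality

distanceToPivot-antitone : ∀ {N a c} → c ≤ a → a ≤ N → ∣ a - N ∣ ≤ ∣ c - N ∣
distanceToPivot-antitone {N} {a} {c} c≤a a≤N
  rewrite m≤n⇒∣m-n∣≡n∸m a≤N | m≤n⇒∣m-n∣≡n∸m (≤-trans c≤a a≤N) = ∸-monoʳ-≤ N c≤a

-- A row-1 box at column a ≤ n−1 is never related to a row-2 box weakly to its
-- left: the latter has the larger value of |c − (n−1)| + r.
row2-left-not-related : ∀ n {a c} → c ≤ a → a ≤ n ∸ 1 → ¬ Related n (1 , a) (2 , c)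
row2-left-not-related n {a} {c} c≤a a≤N rel = 2≰1 (+-cancelˡ-≤ ∣ c - n ∸ 1 ∣ 2 1 two≤one)
  where
  two≤one : ∣ c - n ∸ 1 ∣ + 2 ≤ ∣ c - n ∸ 1 ∣ + 1
  two≤one = subst (_≤ ∣ c - n ∸ 1 ∣ + 1) rel (+-monoˡ-≤ 1 (distanceToPivot-antitone c≤a a≤N))
  2≰1 : ¬ (2 ≤ 1)
  2≰1 (s≤s ())

-- If the first row of δ = (a' , b') is shorter than the first row a ≤ n−1 of γ,
-- then no box of δ ∖ γ is related to the corner box (1:a) of γ: in row 1,
-- δ ∖ γ is empty, and its row-2 boxes lie weakly left of column a.
removedCorner-has-no-partner : ∀ n {a b a' b'} → b' ≤ a' → a' < a → a ≤ n ∸ 1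
  → ∀ y → y ∈ (a' , b') ∖ (a , b) → ¬ Related n (1 , a) y
removedCorner-has-no-partner n b'≤a' a'<a a≤N (zero , c) ((1≤c , c≤0) , _) _ =
  <-irrefl refl (≤-trans 1≤c c≤0)
removedCorner-has-no-partner n b'≤a' a'<a a≤N (1 , c) ((1≤c , c≤a') , c∉γ) _ =
  c∉γ (1≤c , ≤-trans c≤a' (<⇒≤ a'<a))
removedCorner-has-no-partner n b'≤a' a'<a a≤N (2 , c) ((_ , c≤b') , _) =
  row2-left-not-related n (≤-trans c≤b' (≤-trans b'≤a' (<⇒≤ a'<a))) a≤N
removedCorner-has-no-partner n b'≤a' a'<a a≤N (suc (suc (suc r)) , c) ((1≤c , c≤0) , _) _ =
  <-irrefl refl (≤-trans 1≤c c≤0)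

-- If it did, the removed
-- corner box (1:a) would lie in the first n−2 columns and, by condition (2),
-- would need a partner in δ ∖ γ, which the previous lemma rules out.
arrow-firstRow-grows : ∀ n γ δ → Arrow n γ δ → proj₁ γ ≤ proj₁ δ
arrow-firstRow-grows n (a , b) (a' , b') (((e₁ , e₂) , vstrip , hstrip) , _ , (_ , cond2))
  with a ≤? a'
... | yes a≤a' = a≤a'
... | no a≰a' = ⊥-elim (corner-has-no-partner (proj₁ (cond2 (1 , a) (inj₁ (corner∈γ , corner∉δ)))))
  where
  a'<a : a' < a
  a'<a = ≰⇒> a≰a'
  e₁≤a' : e₁ ≤ a'
  e₁≤a' = proj₁ (proj₁ hstrip)
  b'≤a' : b' ≤ a'
  b'≤a' = ≤-trans (proj₂ hstrip) e₁≤a'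
  corner∈γ : (1 , a) ∈D (a , b)
  corner∈γ = ≤-trans (s≤s z≤n) a'<a , ≤-refl
  corner∉δ : ¬ ((1 , a) ∈D (a' , b'))
  corner∉δ (_ , a≤a') = a≰a' a≤a'
  corner∉ε : ¬ ((1 , a) ∈D (e₁ , e₂))
  corner∉ε (_ , a≤e₁) = a≰a' (≤-trans a≤e₁ e₁≤a')
  -- the corner is removed by the vertical strip, hence lies in the first n−2 columns
  a≤N : a ≤ n ∸ 1
  a≤N = ≤-trans (proj₂ (proj₂ (proj₂ (proj₂ vstrip))) (1 , a) (corner∈γ , corner∉ε))
                (∸-monoʳ-≤ n (s≤s z≤n))
  corner-has-no-partner : ¬ ExactlyOneRel n (a , b) (a' , b') (1 , a)
  corner-has-no-partner (y , y∈δ∖γ , related , _) =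
    removedCorner-has-no-partner n b'≤a' a'<a a≤N y y∈δ∖γ related

strips-secondRow-drop : ∀ k γ ε δ → VStripFirstCols k γ ε → HStrip ε δ
  → proj₂ δ < proj₂ γ → proj₂ γ ≡ suc (proj₂ δ)
strips-secondRow-drop k γ ε δ (_ , _ , _ , b≤1+e₂ , _) ((_ , e₂≤b') , _) b'<b =
  ≤-antisym (≤-trans b≤1+e₂ (s≤s e₂≤b')) b'<b

firstRow-from-size : ∀ a a' b' p → a' + b' ≡ a + suc b' + p → a' ≡ a + p + 1
firstRow-from-size a a' b' p size≡ = +-cancelʳ-≡ b' a' (a + p + 1) (trans size≡ (rearrange a b' p))
  where
  open +-*-Solver
  rearrange : ∀ a b' p → a + suc b' + p ≡ a + p + 1 + b'
  rearrange = solve 3 (λ a b' p → a :+ (con 1 :+ b') :+ p := a :+ p :+ con 1 :+ b') refl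

lemma4p3 : (n p : ℕ) → 3 ≤ n → 1 ≤ p → p ≤ 2 * n ∸ 2
    → (γ δ : Partition) → InP n γ → InP n δ
    → size δ ≡ size γ + p
    → Arrow n γ δ → ¬ (γ ⊆P δ)
    → δ ≡ (proj₁ γ + p + 1 , proj₂ γ ∸ 1)
lemma4p3 n p _ _ _ (a , b) (a' , b') _ _ size≡ arrow@((ε , vstrip , hstrip) , _) γ⊈δ
  with b ≤? b'
... | yes b≤b' = ⊥-elim (γ⊈δ (arrow-firstRow-grows n (a , b) (a' , b') arrow , b≤b'))
... | no b≰b' = cong₂ _,_ a'≡ (sym (cong (_∸ 1) b≡))
  where
  -- γ ⊄ δ although the first row grows, so the second row dropped by one box
  b≡ : b ≡ suc b'
  b≡ = strips-secondRow-drop (n ∸ 2) (a , b) ε (a' , b') vstrip hstrip (≰⇒> b≰b')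
  a'≡ : a' ≡ a + p + 1
  a'≡ = firstRow-from-size a a' b' p (trans size≡ (cong (λ r → a + r + p) b≡))
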